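{- For every interpretation $(\mathcal{M},\gamma)$ and all formulas $\varphi,\psi\in Fm$: $(\mathcal{M},\gamma)\vDash\varphi\equiv\psi$ if and only if $\gamma(\varphi)=\gamma(\psi)$.
   Context: Formulas $Fm$ are generated from an infinite set $V$ of propositional variables by the constant $\bot$, binary connectives $\rightarrow,\vee,\wedge$ and unary $\square$; $\varphi\equiv\psi$ abbreviates $\square(\varphi\rightarrow\psi)\wedge\square(\psi\rightarrow\varphi)$. A Heyting algebra $(M,f_\top,f_\bot,f_\vee,f_\wedge,f_\rightarrow)$ is a bounded lattice with top $f_\top$, bottom $f_\bot$, join $f_\vee$, meet $f_\wedge$, order $\le$, and $f_\rightarrow(m,m')$ the greatest $m''$ with $f_\wedge(m,m'')\le m'$. A filter is a non-empty upward closed $F\subseteq M$ closed under $f_\wedge$ with $f_\bot\notin F$; an ultrafilter is a filter maximal under inclusion. A model $\mathcal{M}=(M,\mathit{TRUE},f_\top,f_\bot,f_\rightarrow,f_\vee,f_\wedge,f_\square)$ is a Heyting algebra with an ultrafilter $\mathit{TRUE}$ and a unary operation $f_\square$ such that for all $m,m',m''\in M$: (1) $f_\square(m)\le m$; (2) $f_\square(f_\rightarrow(m,m'))\le f_\rightarrow(f_\square(f_\rightarrow(m',m'')),f_\square(f_\rightarrow(m,m'')))$; (3) $f_\square(f_\vee(m,m'))\le f_\vee(f_\square(m),f_\square(m'))$; (4) $f_\square(m)\in\mathit{TRUE}\iff m=f_\top$. An assignment $\gamma:V\to M$ extends to $Fm$ by $\gamma(\bot)=f_\bot$, $\gamma(\square\varphi)=f_\square(\gamma(\varphi))$,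 $\gamma(\varphi*\psi)=f_*(\gamma(\varphi),\gamma(\psi))$ for $*\in\{\rightarrow,\vee,\wedge\}$. An interpretation is a pair $(\mathcal{M},\gamma)$, and $(\mathcal{M},\gamma)\vDash\varphi$ means $\gamma(\varphi)\in\mathit{TRUE}$. -}

module Defs where

open import Level using (Level; suc; _⊔_)
open import Data.Nat using (ℕ)
open import Data.Product using (_×_; Σ; ∃)
open import Data.Empty using (⊥)
open import Relation.Nullary using (¬_)
open import Relation.Binary.PropositionalEquality using (_≡_)
open import Function.Bundles using (_⇔_)

Var : Set
Var = ℕ

data Fm : Set where
  var  : Var → Fm
  ⊥'   : Fm
  _⇒_  : Fm → Fm → Fm
  _∨'_ : Fm → Fm → Fm
  _∧'_ : Fm → Fm → Fm
  □_   : Fm → Fm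

infixr 5 _⇒_
infixr 6 _∨'_
infixr 7 _∧'_
infix  8 □_

_≡'_ : Fm → Fm → Fm
φ ≡' ψ = (□ (φ ⇒ ψ)) ∧' (□ (ψ ⇒ φ))

record HeytingAlgebra (a : Level) : Set (suc a) where
  field
    M   : Set a
    f⊤  : M
    f⊥  : M
    f∨  : M → M → M
    f∧  : M → M → M
    f→  : M → M → M

  _≤_ : M → M → Set a
  m ≤ m' = f∧ m m' ≡ m

  field
    ∨-assoc : ∀ x y z → f∨ (f∨ x y) z ≡ f∨ x (f∨ y z)
    ∧-assoc : ∀ x y z → f∧ (f∧ x y) z ≡ f∧ x (f∧ y z)
    ∨-comm  : ∀ x y → f∨ x y ≡ f∨ y x
    ∧-comm  : ∀ x y → f∧ x y ≡ f∧ y x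
    ∨-absorbs-∧ : ∀ x y → f∨ x (f∧ x y) ≡ x
    ∧-absorbs-∨ : ∀ x y → f∧ x (f∨ x y) ≡ x
    ⊤-max : ∀ x → x ≤ f⊤
    ⊥-min : ∀ x → f⊥ ≤ x
    →-valid    : ∀ m m' → f∧ m (f→ m m') ≤ m'
    →-greatest : ∀ m m' m'' → f∧ m m'' ≤ m' → m'' ≤ f→ m m'

module _ {a : Level} (H : HeytingAlgebra a) where
  open HeytingAlgebra H

  record IsFilter {ℓ : Level} (F : M → Set ℓ) : Set (a ⊔ ℓ) where
    field
      nonempty : ∃ F
      up-closed : ∀ {m m'} → F m → m ≤ m' → F m'
      ∧-closed  : ∀ {m m'} → F m → F m' → F (f∧ m m')
      proper    : ¬ F f⊥

  -- maximal under inclusion among filters (of the same universe level)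
  record IsUltrafilter {ℓ : Level} (F : M → Set ℓ) : Set (a ⊔ suc ℓ) where
    field
      isFilter : IsFilter F
      maximal  : ∀ (G : M → Set ℓ) → IsFilter G → (∀ m → F m → G m) → ∀ m → G m → F m

record Model (a ℓ : Level) : Set (suc (a ⊔ ℓ)) where
  field
    heyting : HeytingAlgebra a
  open HeytingAlgebra heyting public
  field
    TRUE : M → Set ℓ
    TRUE-ultra : IsUltrafilter heyting TRUE
    f□ : M → M
    □-T : ∀ m → f□ m ≤ m
    □-trans : ∀ m m' m'' →
      f□ (f→ m m') ≤ f→ (f□ (f→ m' m'')) (f□ (f→ m m''))
    □-∨ : ∀ m m' → f□ (f∨ m m') ≤ f∨ (f□ m) (f□ m')
    □-TRUE : ∀ m → (TRUE (f□ m) ⇔ (m ≡ f⊤))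

module _ {a ℓ : Level} (𝓜 : Model a ℓ) where
  open Model 𝓜

  Assignment : Set a
  Assignment = Var → M

  ⟦_⟧ : Fm → Assignment → M
  ⟦ var x ⟧ γ = γ x
  ⟦ ⊥' ⟧ γ = f⊥
  ⟦ φ ⇒ ψ ⟧ γ = f→ (⟦ φ ⟧ γ) (⟦ ψ ⟧ γ)
  ⟦ φ ∨' ψ ⟧ γ = f∨ (⟦ φ ⟧ γ) (⟦ ψ ⟧ γ)
  ⟦ φ ∧' ψ ⟧ γ = f∧ (⟦ φ ⟧ γ) (⟦ ψ ⟧ γ)
  ⟦ □ φ ⟧ γ = f□ (⟦ φ ⟧ γ)

  _⊨_ : Assignment → Fm → Set ℓ
  γ ⊨ φ = TRUE (⟦ φ ⟧ γ)

-- By axiom (4), TRUE (□ (x → y)) holds exactly when x → y is the top element,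
-- i.e. when x ≤ y. Since TRUE is a filter, it contains the meet of the two boxed
-- implications iff it contains both, so the formula φ ≡ ψ is true iff
-- ⟦φ⟧ ≤ ⟦ψ⟧ and ⟦ψ⟧ ≤ ⟦φ⟧, which is ⟦φ⟧ = ⟦ψ⟧ by antisymmetry.
module Submission where

open import Defs
open import Level using (Level)
open import Relation.Binary.PropositionalEquality
  using (_≡_; refl; sym; trans; cong; subst; module ≡-Reasoning)
open import Function.Bundles using (_⇔_; mk⇔; Equivalence)
open import Data.Product using (_×_; _,_)

module HeytingProperties {a : Level} (H : HeytingAlgebra a) where
  open HeytingAlgebra H
  open ≡-Reasoning

  ∧-idem : ∀ x → f∧ x x ≡ x
  ∧-idem x = begin
    f∧ x x                  ≡⟨ cong (f∧ x) (sym (∨-absorbs-∧ x x)) ⟩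
    f∧ x (f∨ x (f∧ x x))    ≡⟨ ∧-absorbs-∨ x (f∧ x x) ⟩
    x                       ∎

  ≤-reflexive : ∀ {x y} → x ≡ y → x ≤ y
  ≤-reflexive {x} refl = ∧-idem x

  ≤-antisym : ∀ {x y} → x ≤ y → y ≤ x → x ≡ y
  ≤-antisym {x} {y} x≤y y≤x = trans (sym x≤y) (trans (∧-comm x y) y≤x)

  x∧y≤x : ∀ x y → f∧ x y ≤ x
  x∧y≤x x y = begin
    f∧ (f∧ x y) x   ≡⟨ ∧-assoc x y x ⟩
    f∧ x (f∧ y x)   ≡⟨ cong (f∧ x) (∧-comm y x) ⟩
    f∧ x (f∧ x y)   ≡⟨ sym (∧-assoc x x y) ⟩
    f∧ (f∧ x x) y   ≡⟨ cong (λ z → f∧ z y) (∧-idem x) ⟩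
    f∧ x y          ∎

  x∧y≤y : ∀ x y → f∧ x y ≤ y
  x∧y≤y x y = subst (_≤ y) (∧-comm y x) (x∧y≤x y x)

  x∧⊤≡x : ∀ x → f∧ x f⊤ ≡ x
  x∧⊤≡x = ⊤-max

  →≡⊤⇒≤ : ∀ {x y} → f→ x y ≡ f⊤ → x ≤ y
  →≡⊤⇒≤ {x} {y} x→y≡⊤ =
    subst (λ z → f∧ z y ≡ z) (x∧⊤≡x x)
      (subst (λ t → f∧ x t ≤ y) x→y≡⊤ (→-valid x y))

  ≤⇒→≡⊤ : ∀ {x y} → x ≤ y → f→ x y ≡ f⊤
  ≤⇒→≡⊤ {x} {y} x≤y =
    ≤-antisym (⊤-max (f→ x y))
      (→-greatest x y f⊤ (subst (_≤ y) (sym (x∧⊤≡x x)) x≤y))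

  →≡⊤⇔≤ : ∀ x y → (f→ x y ≡ f⊤) ⇔ (x ≤ y)
  →≡⊤⇔≤ x y = mk⇔ →≡⊤⇒≤ ≤⇒→≡⊤

module FilterProperties {a ℓ : Level} (H : HeytingAlgebra a)
                        {F : HeytingAlgebra.M H → Set ℓ} (isFilter : IsFilter H F) where
  open HeytingAlgebra H
  open HeytingProperties H
  open IsFilter isFilter

  ∧∈⇔∈×∈ : ∀ x y → F (f∧ x y) ⇔ (F x × F y)
  ∧∈⇔∈×∈ x y = mk⇔
    (λ x∧y∈F → up-closed x∧y∈F (x∧y≤x x y) , up-closed x∧y∈F (x∧y≤y x y))
    (λ (x∈F , y∈F) → ∧-closed x∈F y∈F)

module ModelProperties {a ℓ : Level} (𝓜 : Model a ℓ) where
  open Model 𝓜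
  open HeytingProperties heyting
  open FilterProperties heyting (IsUltrafilter.isFilter TRUE-ultra)
  open Equivalence

  □→-TRUE⇔≤ : ∀ x y → TRUE (f□ (f→ x y)) ⇔ (x ≤ y)
  □→-TRUE⇔≤ x y = mk⇔
    (λ t → to (→≡⊤⇔≤ x y) (to (□-TRUE (f→ x y)) t))
    (λ x≤y → from (□-TRUE (f→ x y)) (from (→≡⊤⇔≤ x y) x≤y))

  ⊨≡'⇔≤×≥ : ∀ γ φ ψ →
    _⊨_ 𝓜 γ (φ ≡' ψ) ⇔ (⟦_⟧ 𝓜 φ γ ≤ ⟦_⟧ 𝓜 ψ γ × ⟦_⟧ 𝓜 ψ γ ≤ ⟦_⟧ 𝓜 φ γ)
  ⊨≡'⇔≤×≥ γ φ ψ = mk⇔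
    (λ t → let (t₁ , t₂) = to (∧∈⇔∈×∈ _ _) t in
           to (□→-TRUE⇔≤ A B) t₁ , to (□→-TRUE⇔≤ B A) t₂)
    (λ (A≤B , B≤A) → from (∧∈⇔∈×∈ _ _)
           (from (□→-TRUE⇔≤ A B) A≤B , from (□→-TRUE⇔≤ B A) B≤A))
    where
    A = ⟦_⟧ 𝓜 φ γ
    B = ⟦_⟧ 𝓜 ψ γ

theorem3p6 : {a ℓ : Level} (𝓜 : Model a ℓ) (γ : Assignment 𝓜) (φ ψ : Fm) →
    (_⊨_ 𝓜 γ (φ ≡' ψ)) ⇔ (⟦_⟧ 𝓜 φ γ ≡ ⟦_⟧ 𝓜 ψ γ)
theorem3p6 𝓜 γ φ ψ = mk⇔
  (λ t → let (A≤B , B≤A) = to (⊨≡'⇔≤×≥ γ φ ψ) t in ≤-antisym A≤B B≤A)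
  (λ A≡B → from (⊨≡'⇔≤×≥ γ φ ψ) (≤-reflexive A≡B , ≤-reflexive (sym A≡B)))
  where
  open HeytingProperties (Model.heyting 𝓜)
  open ModelProperties 𝓜
  open Equivalence
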